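{- Let $(X,Y)$ be an arc of a fixed circle and let $\mathcal{A}$, $\mathcal{B}$ be finite sets of chords of this circle satisfying: (1) every triangle in $G(\mathcal{A}\cup\mathcal{B})$ contains at most one chord of $\mathcal{B}$; (2) each chord of $\mathcal{A}$ has exactly one endpoint on the arc $(X,Y)$; (3) for each chord $b\in\mathcal{B}$, both endpoints of $b$ lie on the arc $(X,Y)$, and there exists a chord $a\in\mathcal{A}$ that intersects $b$. Then $G(\mathcal{B})$ admits a proper coloring with $3$ colors.
   Context: Fix a circle. For a finite set $\mathcal{S}$ of chords of this circle, the circle graph $G(\mathcal{S})$ has vertex set $\mathcal{S}$, and two chords are adjacent (are said to intersect) if and only if they have a common inner point. A triangle in $G(\mathcal{S})$ is a set of three pairwise adjacent vertices, i.e. three pairwise intersecting chords. A proper coloring assigns colors to vertices so that adjacent vertices receive different colors. -}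

module Defs where

open import Data.Nat using (ℕ; _<_; _≤_)
open import Data.Product using (_×_)
open import Data.Sum using (_⊎_)

-- Points of the fixed circle are labelled by natural numbers, listed in
-- the (counterclockwise) cyclic order: going around the circle one meets
-- 0, 1, 2, ... and then wraps around. Only the cyclic order of the finitely
-- many relevant points matters, so this loses no generality.

record Chord : Set where
  constructor chord
  field
    left  : ℕ
    right : ℕ
    left<right : left < right
open Chord public

-- Two chords have a common inner point iff their endpoints strictly
-- interleave along the circle (chords sharing an endpoint, or nested/disjoint
-- chords, do not intersect).
Intersect : Chord → Chord → Set
Intersect c d =
  (left c < left d × left d < right c × right c < right d)
  ⊎ (left d < left c × left c < right d × right d < right c)

-- The open arc (X,Y): points met strictly after X and strictly before Y when
-- travelling around the circle in the positive direction from X.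
OnArc : ℕ → ℕ → ℕ → Set
OnArc X Y p = (X < p × p < Y) ⊎ (Y ≤ X × (X < p ⊎ p < Y))

-- Cut the circle open at X, so that the arc (X , Y) becomes an initial segment
-- of a line. The chords of ℬ become intervals in it, and each chord of 𝒜 has
-- exactly one endpoint p there, crossing a chord of ℬ exactly when p lies inside
-- its interval. Every interval contains such a point, and no point lies in the
-- overlap of two crossing intervals, since that would give a triangle with two
-- chords of ℬ. Compress the line to the gaps between these points: each
-- interval becomes an edge between two gaps, two crossing intervals become
-- edges where the right end of the first is the left end of the second, and the
-- edges do not cross. So colouring every interval by the colour of its left gap
-- in a proper 3-colouring of this outerplanar graph works. Such a colouring
-- exists because the vertex just inside a shortest edge of length at least 2
-- has no neighbours besides its two immediate ones; delete it, colour the rest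
-- and colour it last.
module Submission where

open import Defs
open import Data.Nat using (ℕ)
open import Data.Fin using (Fin)
open import Data.List using (List; _++_)
open import Data.List.Membership.Propositional using (_∈_)
open import Data.Product using (Σ; _×_; ∃-syntax)
open import Data.Sum using (_⊎_)
open import Data.Empty using (⊥)
open import Relation.Nullary using (¬_)
open import Relation.Binary.PropositionalEquality using (_≡_; _≢_)

open import Data.Nat
  using (zero; suc; pred; _<_; _≤_; _∸_; _⊓_; _⊔_; z≤n; s≤s; z<s; s<s; s≤s⁻¹; s<s⁻¹;
         _<?_; _≤?_; _≟_; >-nonZero)
open import Data.Nat.Properties
open import Data.Nat.GeneralisedArithmetic using (iterate)
open import Data.Fin.Patterns using (0F; 1F; 2F)
open import Data.List using ([]; _∷_; map; filter)
open import Data.List.Membership.Propositional.Properties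
  using (∈-map⁺; ∈-map⁻; ∈-filter⁺; ∈-filter⁻; ∈-++⁺ˡ; ∈-++⁺ʳ)
open import Data.List.Relation.Unary.Any using (here; there)
import Data.List.Relation.Unary.All as All
open import Data.List.Extrema.Nat
  using (argmin; argmin-sel; f[argmin]≤f[⊤]; f[argmin]≤f[xs]; max; xs≤max; ⊥≤max)
open import Data.Product using (_,_; proj₁; proj₂)
import Data.Product as Product
open import Data.Sum using (inj₁; inj₂; [_,_])
import Data.Sum as Sum
open import Data.Empty using (⊥-elim)
open import Function using (case_of_; _∘_; id)
open import Relation.Nullary using (yes; no)
open import Relation.Nullary.Decidable using (¬?; _×-dec_)
open import Relation.Unary using (Decidable)
open import Relation.Binary.Definitions using (tri<; tri≈; tri>)
open import Relation.Binary.PropositionalEquality using (refl; sym; trans; cong; cong₂; subst)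

third : (a b : Fin 3) → ∃[ c ] (c ≢ a × c ≢ b)
third 0F 0F = 1F , (λ ()) , (λ ())
third 0F 1F = 2F , (λ ()) , (λ ())
third 0F 2F = 1F , (λ ()) , (λ ())
third 1F 0F = 2F , (λ ()) , (λ ())
third 1F 1F = 0F , (λ ()) , (λ ())
third 1F 2F = 0F , (λ ()) , (λ ())
third 2F 0F = 1F , (λ ()) , (λ ())
third 2F 1F = 0F , (λ ()) , (λ ())
third 2F 2F = 0F , (λ ()) , (λ ())

module _ {A : Set} {P : A → Set} (P? : Decidable P) (f : A → ℕ) where

  none-or-minimal : (xs : List A) →
    (∀ {x} → x ∈ xs → ¬ P x) ⊎
    (∃[ x ] (x ∈ xs × P x × (∀ {y} → y ∈ xs → P y → f x ≤ f y)))
  none-or-minimal xs with filter P? xs in eq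
  ... | [] = inj₁ λ x∈ px → case subst (_ ∈_) eq (∈-filter⁺ P? x∈ px) of λ ()
  ... | y ∷ ys = inj₂ (m , proj₁ m∈xs×pm , proj₂ m∈xs×pm , minimal)
    where
    m : A
    m = argmin f y ys
    m∈ : m ∈ filter P? xs
    m∈ = subst (m ∈_) (sym eq) (case argmin-sel f y ys of λ
      { (inj₁ m≡y) → here m≡y ; (inj₂ m∈ys) → there m∈ys })
    m∈xs×pm : m ∈ xs × P m
    m∈xs×pm = ∈-filter⁻ P? {xs = xs} m∈
    minimal : ∀ {z} → z ∈ xs → P z → f m ≤ f z
    minimal z∈ pz with subst (_ ∈_) eq (∈-filter⁺ P? z∈ pz)
    ... | here refl = f[argmin]≤f[⊤] {f = f} y ys
    ... | there z∈ys = All.lookup (f[argmin]≤f[xs] {f = f} y ys) z∈ys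

Edge : Set
Edge = ℕ × ℕ

Crosses : Edge → Edge → Set
Crosses (a , b) (c , d) = a < c × c < b × b < d

Interleave : Edge → Edge → Set
Interleave u v = Crosses u v ⊎ Crosses v u

Increasing : List Edge → Set
Increasing E = ∀ {e} → e ∈ E → proj₁ e < proj₂ e

NonCrossing : List Edge → Set
NonCrossing E = ∀ {e f} → e ∈ E → f ∈ E → ¬ Crosses e f

ProperColouring : (ℕ → Fin 3) → List Edge → Set
ProperColouring g E = ∀ {e} → e ∈ E → g (proj₁ e) ≢ g (proj₂ e)

ThreeColourable : List Edge → Set
ThreeColourable E = ∃[ g ] ProperColouring g E

Long : Edge → Set
Long (i , j) = suc i < j

long? : Decidable Long
long? (i , j) = suc i <? j

span : Edge → ℕ
span (i , j) = j ∸ i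

short-edge : ∀ {i j} → i < j → ¬ suc i < j → j ≡ suc i
short-edge i<j ¬long = ≤-antisym (≮⇒≥ ¬long) i<j

alternating : ℕ → Fin 3
alternating zero = 0F
alternating (suc n) = proj₁ (third (alternating n) (alternating n))

alternating-proper : ∀ {E} → Increasing E → (∀ {e} → e ∈ E → ¬ Long e) →
                     ProperColouring alternating E
alternating-proper inc short {i , j} e∈ rewrite short-edge (inc e∈) (short e∈) =
  λ eq → proj₁ (proj₂ (third (alternating i) (alternating i))) (sym eq)

squeeze : ℕ → ℕ → ℕ
squeeze x y with y ≤? x
... | yes _ = y
... | no _ = pred y

squeeze-below : ∀ {x y} → y ≤ x → squeeze x y ≡ y
squeeze-below {x} {y} y≤x with y ≤? x
... | yes _ = refl
... | no y≰x = ⊥-elim (y≰x y≤x)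

squeeze-above : ∀ {x y} → x < y → squeeze x y ≡ pred y
squeeze-above {x} {y} x<y with y ≤? x
... | yes y≤x = ⊥-elim (<⇒≱ x<y y≤x)
... | no _ = refl

squeeze-cases : ∀ {x y} → y ≢ x →
                (y < x × squeeze x y ≡ y) ⊎ (x < y × squeeze x y ≡ pred y)
squeeze-cases {x} {y} y≢x with y ≤? x
... | yes y≤x = inj₁ (≤∧≢⇒< y≤x y≢x , refl)
... | no y≰x = inj₂ (≰⇒> y≰x , refl)

squeeze-mono : ∀ {x y z} → y ≢ x → z ≢ x → y < z → squeeze x y < squeeze x z
squeeze-mono y≢x z≢x y<z with squeeze-cases y≢x | squeeze-cases z≢x
... | inj₁ (_ , eqy) | inj₁ (_ , eqz) rewrite eqy | eqz = y<z
... | inj₁ (y<x , eqy) | inj₂ (x<z , eqz) rewrite eqy | eqz = <-≤-trans y<x (<⇒≤pred x<z)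
... | inj₂ (x<y , _) | inj₁ (z<x , _) = ⊥-elim (<-asym (<-trans x<y y<z) z<x)
... | inj₂ (x<y , eqy) | inj₂ (_ , eqz) rewrite eqy | eqz =
  pred-mono-< ⦃ >-nonZero (≤-<-trans z≤n x<y) ⦄ y<z

squeeze-reflects : ∀ {x y z} → y ≢ x → z ≢ x → squeeze x y < squeeze x z → y < z
squeeze-reflects {y = y} {z} y≢x z≢x lt with <-cmp y z
... | tri< y<z _ _ = y<z
... | tri≈ _ refl _ = ⊥-elim (<-irrefl refl lt)
... | tri> _ _ z<y = ⊥-elim (<-asym lt (squeeze-mono z≢x y≢x z<y))

squeeze-bounded : ∀ {n x y} → x ≤ n → y ≤ suc n → squeeze x y ≤ n
squeeze-bounded {x = x} {y} x≤n y≤1+n with y ≤? x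
... | yes y≤x = ≤-trans y≤x x≤n
... | no _ = pred-mono-≤ y≤1+n

Avoids : ℕ → Edge → Set
Avoids x (a , b) = a ≢ x × b ≢ x

avoids? : ∀ x → Decidable (Avoids x)
avoids? x (a , b) = ¬? (a ≟ x) ×-dec ¬? (b ≟ x)

squeezeEdge : ℕ → Edge → Edge
squeezeEdge x = Product.map (squeeze x) (squeeze x)

removeVertex : ℕ → List Edge → List Edge
removeVertex x E = map (squeezeEdge x) (filter (avoids? x) E)

module _ {x : ℕ} {E : List Edge} where

  removeVertex-∈⁺ : ∀ {e} → e ∈ E → Avoids x e → squeezeEdge x e ∈ removeVertex x E
  removeVertex-∈⁺ e∈ avoids = ∈-map⁺ (squeezeEdge x) (∈-filter⁺ (avoids? x) e∈ avoids)

  removeVertex-∈⁻ : ∀ {e′} → e′ ∈ removeVertex x E →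
                    ∃[ e ] (e ∈ E × Avoids x e × e′ ≡ squeezeEdge x e)
  removeVertex-∈⁻ e′∈ with ∈-map⁻ (squeezeEdge x) e′∈
  ... | e , e∈ , refl = e , Product.map₂ (_, refl) (∈-filter⁻ (avoids? x) {xs = E} e∈)

  removeVertex-increasing : Increasing E → Increasing (removeVertex x E)
  removeVertex-increasing inc e′∈ with removeVertex-∈⁻ e′∈
  ... | e , e∈ , (a≢x , b≢x) , refl = squeeze-mono a≢x b≢x (inc e∈)

  removeVertex-nonCrossing : NonCrossing E → NonCrossing (removeVertex x E)
  removeVertex-nonCrossing nc e′∈ f′∈ (a<c , c<b , b<d)
    with removeVertex-∈⁻ e′∈ | removeVertex-∈⁻ f′∈
  ... | e , e∈ , (a≢x , b≢x) , refl | f , f∈ , (c≢x , d≢x) , refl =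
    nc e∈ f∈ ( squeeze-reflects a≢x c≢x a<c
             , squeeze-reflects c≢x b≢x c<b
             , squeeze-reflects b≢x d≢x b<d )

  removeVertex-bounded : ∀ {n} → x ≤ n → (∀ {e} → e ∈ E → proj₂ e ≤ suc n) →
                         ∀ {e′} → e′ ∈ removeVertex x E → proj₂ e′ ≤ n
  removeVertex-bounded x≤n bounded e′∈ with removeVertex-∈⁻ e′∈
  ... | e , e∈ , _ , refl = squeeze-bounded x≤n (bounded e∈)

insertColour : ℕ → Fin 3 → (ℕ → Fin 3) → ℕ → Fin 3
insertColour x c g y with y ≟ x
... | yes _ = c
... | no _ = g (squeeze x y)

insertColour-off : ∀ {x y} c g → y ≢ x → insertColour x c g y ≡ g (squeeze x y)
insertColour-off {x} {y} c g y≢x with y ≟ x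
... | yes y≡x = ⊥-elim (y≢x y≡x)
... | no _ = refl

reinsertVertex : ∀ {E i x} → i < x →
                 (∀ {y} → (x , y) ∈ E → y ≡ suc x) →
                 (∀ {y} → (y , x) ∈ E → y ≡ i) →
                 ThreeColourable (removeVertex x E) → ThreeColourable E
reinsertVertex {E} {i} {x} i<x from-x into-x (g , proper) with third (g i) (g x)
... | c , c≢gi , c≢gx = insertColour x c g , proper′
  where
  proper′ : ProperColouring (insertColour x c g) E
  proper′ {a , b} e∈ with a ≟ x
  ... | yes refl rewrite from-x e∈ | insertColour-off c g (>⇒≢ (n<1+n a))
                       | squeeze-above (n<1+n a) = c≢gx
  ... | no a≢x with b ≟ x
  ...   | yes refl rewrite into-x e∈ | squeeze-below (<⇒≤ i<x) = c≢gi ∘ sym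
  ...   | no b≢x = proper (removeVertex-∈⁺ e∈ (a≢x , b≢x))

module MinimalLongEdge {E : List Edge} (inc : Increasing E) (nc : NonCrossing E)
  {i j : ℕ} (ij∈ : (i , j) ∈ E) (long : Long (i , j))
  (minimal : ∀ {e} → e ∈ E → Long e → j ∸ i ≤ span e) where

  from-next : ∀ {y} → (suc i , y) ∈ E → y ≡ suc (suc i)
  from-next {y} e∈ with suc (suc i) <? y
  ... | no ¬long = short-edge (inc e∈) ¬long
  ... | yes long′ with j <? y
  ...   | yes j<y = ⊥-elim (nc ij∈ e∈ (n<1+n i , long , j<y))
  ...   | no j≮y = ⊥-elim (<⇒≱ shorter (minimal e∈ long′))
    where
    shorter : y ∸ suc i < j ∸ i
    shorter = ≤-<-trans (∸-monoˡ-≤ (suc i) (≮⇒≥ j≮y)) (∸-monoʳ-< (n<1+n i) (<⇒≤ long))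

  into-next : ∀ {y} → (y , suc i) ∈ E → y ≡ i
  into-next e∈ with m≤n⇒m<n∨m≡n (s≤s⁻¹ (inc e∈))
  ... | inj₁ y<i = ⊥-elim (nc e∈ ij∈ (y<i , n<1+n i , long))
  ... | inj₂ y≡i = y≡i

three-colourable-≤ : ∀ n E → (∀ {e} → e ∈ E → proj₂ e ≤ n) →
                     Increasing E → NonCrossing E → ThreeColourable E
three-colourable-≤ zero E bounded inc nc =
  alternating , λ e∈ → ⊥-elim (n≮0 (<-≤-trans (inc e∈) (bounded e∈)))
three-colourable-≤ (suc n) E bounded inc nc with none-or-minimal long? span E
... | inj₁ short = alternating , alternating-proper inc short
... | inj₂ ((i , j) , ij∈ , long , minimal) =
  reinsertVertex (n<1+n i) from-next into-next
    (three-colourable-≤ n (removeVertex (suc i) E)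
      (removeVertex-bounded (s≤s⁻¹ (<-≤-trans long (bounded ij∈))) bounded)
      (removeVertex-increasing inc) (removeVertex-nonCrossing nc))
  where open MinimalLongEdge inc nc ij∈ long minimal

three-colourable : ∀ {E} → Increasing E → NonCrossing E → ThreeColourable E
three-colourable {E} =
  three-colourable-≤ _ E (λ e∈ → All.lookup (xs≤max 0 (map proj₂ E)) (∈-map⁺ proj₂ e∈))

rank : List ℕ → ℕ → ℕ
rank [] x = 0
rank (p ∷ P) x with p <? x
... | yes _ = suc (rank P x)
... | no _ = rank P x

rank-mono : ∀ P {x y} → x ≤ y → rank P x ≤ rank P y
rank-mono [] x≤y = z≤n
rank-mono (p ∷ P) {x} {y} x≤y with p <? x | p <? y
... | yes _ | yes _ = s≤s (rank-mono P x≤y)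
... | yes p<x | no p≮y = ⊥-elim (p≮y (<-≤-trans p<x x≤y))
... | no _ | yes _ = m≤n⇒m≤1+n (rank-mono P x≤y)
... | no _ | no _ = rank-mono P x≤y

rank-strict : ∀ {P p x y} → p ∈ P → x ≤ p → p < y → rank P x < rank P y
rank-strict {q ∷ P} {p} {x} {y} p∈ x≤p p<y with q <? x | q <? y | p∈
... | yes q<x | _ | here refl = ⊥-elim (<⇒≱ q<x x≤p)
... | no _ | yes _ | here refl = s≤s (rank-mono P (≤-trans x≤p (<⇒≤ p<y)))
... | no _ | no q≮y | here refl = ⊥-elim (q≮y p<y)
... | yes _ | yes _ | there p∈P = s≤s (rank-strict p∈P x≤p p<y)
... | yes q<x | no q≮y | there _ = ⊥-elim (q≮y (<-trans q<x (≤-<-trans x≤p p<y)))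
... | no _ | yes _ | there p∈P = m<n⇒m<1+n (rank-strict p∈P x≤p p<y)
... | no _ | no _ | there p∈P = rank-strict p∈P x≤p p<y

rank-witness : ∀ {P x y} → rank P x < rank P y → ∃[ p ] (p ∈ P × x ≤ p × p < y)
rank-witness {q ∷ P} {x} {y} lt with q <? x | q <? y
... | yes _ | yes _ = Product.map₂ (Product.map₁ there) (rank-witness (s<s⁻¹ lt))
... | yes _ | no _ = Product.map₂ (Product.map₁ there) (rank-witness (<⇒≤ lt))
... | no q≮x | yes q<y = q , here refl , ≮⇒≥ q≮x , q<y
... | no _ | no _ = Product.map₂ (Product.map₁ there) (rank-witness lt)

-- Intervals in I are compressed to edges between the gaps of P: an interval
-- (a , b) becomes the edge from the gap just after a to the gap just before b.
module Compression (P : List ℕ) (I : List Edge)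
  (pierced : ∀ {u} → u ∈ I → ∃[ p ] (p ∈ P × proj₁ u < p × p < proj₂ u))
  (overlap-avoids-P : ∀ {u v p} → u ∈ I → v ∈ I → p ∈ P →
                      Crosses u v → proj₁ v < p → p < proj₂ u → ⊥) where

  compress : Edge → Edge
  compress (a , b) = rank P (suc a) , rank P b

  compressed-increasing : Increasing (map compress I)
  compressed-increasing e∈ with ∈-map⁻ compress e∈
  ... | u , u∈ , refl with pierced u∈
  ...   | p , p∈ , a<p , p<b = rank-strict p∈ a<p p<b

  compressed-nonCrossing : NonCrossing (map compress I)
  compressed-nonCrossing e∈ f∈ (a′<c′ , c′<b′ , b′<d′)
    with ∈-map⁻ compress e∈ | ∈-map⁻ compress f∈
  ... | (a , b) , u∈ , refl | (c , d) , v∈ , refl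
    with rank-witness {P} {suc a} a′<c′ | rank-witness {P} {suc c} c′<b′
       | rank-witness {P} {b} b′<d′
  ... | _ , _ , a<p , p≤c | q , q∈ , c<q , q<b | _ , _ , b≤r , r<d =
    overlap-avoids-P u∈ v∈ q∈ (≤-trans a<p (s≤s⁻¹ p≤c) , <-trans c<q q<b , ≤-<-trans b≤r r<d)
      c<q q<b

  crossing-compress-meet : ∀ {u v} → u ∈ I → v ∈ I → Crosses u v →
                           proj₂ (compress u) ≡ proj₁ (compress v)
  crossing-compress-meet {a , b} {c , d} u∈ v∈ cross@(_ , c<b , _) =
    ≤-antisym (≮⇒≥ no-point-between) (rank-mono P c<b)
    where
    no-point-between : ¬ rank P (suc c) < rank P b
    no-point-between lt with rank-witness {P} {suc c} lt
    ... | p , p∈ , c<p , p<b = overlap-avoids-P u∈ v∈ p∈ cross c<p p<b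

  crossing-colouring : ∃[ col ] (∀ {u v} → u ∈ I → v ∈ I → Interleave u v → col u ≢ col v)
  crossing-colouring with three-colourable compressed-increasing compressed-nonCrossing
  ... | g , g-proper = g ∘ proj₁ ∘ compress ,
                       λ u∈ v∈ → [ proper u∈ v∈ , (λ cross → proper v∈ u∈ cross ∘ sym) ]
    where
    proper : ∀ {u v} → u ∈ I → v ∈ I → Crosses u v →
             g (proj₁ (compress u)) ≢ g (proj₁ (compress v))
    proper u∈ v∈ cross eq = g-proper (∈-map⁺ compress u∈)
      (trans eq (cong g (sym (crossing-compress-meet u∈ v∈ cross))))

Cyc : ℕ → ℕ → ℕ → Set
Cyc a b c = (a < b × b < c) ⊎ (b < c × c < a) ⊎ (c < a × a < b)

Cyc-rotate : ∀ {a b c} → Cyc a b c → Cyc b c a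
Cyc-rotate (inj₁ h) = inj₂ (inj₂ h)
Cyc-rotate (inj₂ (inj₁ h)) = inj₁ h
Cyc-rotate (inj₂ (inj₂ h)) = inj₂ (inj₁ h)

Cyc-transport : ∀ {f g : ℕ → ℕ} → (∀ {m n} → f m < f n → g m < g n) →
                ∀ {a b c} → Cyc (f a) (f b) (f c) → Cyc (g a) (g b) (g c)
Cyc-transport h = Sum.map (Product.map h h) (Sum.map (Product.map h h) (Product.map h h))

Cyc-between : ∀ {a b c} → a ≤ c → Cyc a b c → a < b × b < c
Cyc-between a≤c (inj₁ h) = h
Cyc-between a≤c (inj₂ (inj₁ (_ , c<a))) = ⊥-elim (<⇒≱ c<a a≤c)
Cyc-between a≤c (inj₂ (inj₂ (c<a , _))) = ⊥-elim (<⇒≱ c<a a≤c)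

Cyc-outside : ∀ {a b c} → Cyc c b a → c < b ⊎ b < a
Cyc-outside (inj₁ (c<b , _)) = inj₁ c<b
Cyc-outside (inj₂ (inj₁ (b<a , _))) = inj₂ b<a
Cyc-outside (inj₂ (inj₂ (_ , c<b))) = inj₁ c<b

module Rotation (M : ℕ) where

  ρ : ℕ → ℕ
  ρ zero = M
  ρ (suc p) = p

  ρ-bounded : ∀ {p} → p ≤ M → ρ p ≤ M
  ρ-bounded {zero} _ = ≤-refl
  ρ-bounded {suc p} p<M = <⇒≤ p<M

  ρ-Cyc-zero : ∀ {b c} → c ≤ M → Cyc 0 b c → Cyc M (ρ b) (ρ c)
  ρ-Cyc-zero {suc b} {suc c} c≤M (inj₁ (_ , b<c)) = inj₂ (inj₁ (s<s⁻¹ b<c , c≤M))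
  ρ-Cyc-zero {zero} _ (inj₁ (() , _))
  ρ-Cyc-zero {suc b} {zero} _ (inj₁ (_ , ()))
  ρ-Cyc-zero _ (inj₂ (inj₁ (_ , ())))
  ρ-Cyc-zero _ (inj₂ (inj₂ (() , _)))

  ρ-Cyc : ∀ {a b c} → a ≤ M → b ≤ M → c ≤ M → Cyc a b c → Cyc (ρ a) (ρ b) (ρ c)
  ρ-Cyc {zero} _ _ c≤M h = ρ-Cyc-zero c≤M h
  ρ-Cyc {suc a} {zero} a≤M _ _ h = Cyc-rotate (Cyc-rotate (ρ-Cyc-zero a≤M (Cyc-rotate h)))
  ρ-Cyc {suc a} {suc b} {zero} _ b≤M _ h =
    Cyc-rotate (ρ-Cyc-zero b≤M (Cyc-rotate (Cyc-rotate h)))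
  ρ-Cyc {suc a} {suc b} {suc c} _ _ _ h = Cyc-transport {f = suc} {g = id} s<s⁻¹ h

  ρ-Cyc⁻-zero : ∀ {b c} → b ≤ M → c ≤ M → Cyc M (ρ b) (ρ c) → Cyc 0 b c
  ρ-Cyc⁻-zero b≤M _ (inj₁ (M<ρb , _)) = ⊥-elim (<⇒≱ M<ρb (ρ-bounded b≤M))
  ρ-Cyc⁻-zero b≤M _ (inj₂ (inj₂ (_ , M<ρb))) = ⊥-elim (<⇒≱ M<ρb (ρ-bounded b≤M))
  ρ-Cyc⁻-zero {zero} _ c≤M (inj₂ (inj₁ (M<ρc , _))) = ⊥-elim (<⇒≱ M<ρc (ρ-bounded c≤M))
  ρ-Cyc⁻-zero {suc b} {zero} _ _ (inj₂ (inj₁ (_ , M<M))) = ⊥-elim (<-irrefl refl M<M)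
  ρ-Cyc⁻-zero {suc b} {suc c} _ _ (inj₂ (inj₁ (b<c , _))) = inj₁ (z<s , s<s b<c)

  ρ-Cyc⁻ : ∀ {a b c} → a ≤ M → b ≤ M → c ≤ M → Cyc (ρ a) (ρ b) (ρ c) → Cyc a b c
  ρ-Cyc⁻ {zero} _ b≤M c≤M h = ρ-Cyc⁻-zero b≤M c≤M h
  ρ-Cyc⁻ {suc a} {zero} a≤M _ c≤M h =
    Cyc-rotate (Cyc-rotate (ρ-Cyc⁻-zero c≤M a≤M (Cyc-rotate h)))
  ρ-Cyc⁻ {suc a} {suc b} {zero} a≤M b≤M _ h =
    Cyc-rotate (ρ-Cyc⁻-zero a≤M b≤M (Cyc-rotate (Cyc-rotate h)))
  ρ-Cyc⁻ {suc a} {suc b} {suc c} _ _ _ h = Cyc-transport {f = id} {g = suc} s<s h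

  rotate : ℕ → ℕ → ℕ
  rotate k p = iterate ρ p k

  rotate-bounded : ∀ k {p} → p ≤ M → rotate k p ≤ M
  rotate-bounded zero p≤M = p≤M
  rotate-bounded (suc k) p≤M = rotate-bounded k (ρ-bounded p≤M)

  rotate-Cyc : ∀ k {a b c} → a ≤ M → b ≤ M → c ≤ M →
               Cyc a b c → Cyc (rotate k a) (rotate k b) (rotate k c)
  rotate-Cyc zero _ _ _ h = h
  rotate-Cyc (suc k) a≤M b≤M c≤M h =
    rotate-Cyc k (ρ-bounded a≤M) (ρ-bounded b≤M) (ρ-bounded c≤M) (ρ-Cyc a≤M b≤M c≤M h)

  rotate-Cyc⁻ : ∀ k {a b c} → a ≤ M → b ≤ M → c ≤ M →
                Cyc (rotate k a) (rotate k b) (rotate k c) → Cyc a b c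
  rotate-Cyc⁻ zero _ _ _ h = h
  rotate-Cyc⁻ (suc k) a≤M b≤M c≤M h =
    ρ-Cyc⁻ a≤M b≤M c≤M (rotate-Cyc⁻ k (ρ-bounded a≤M) (ρ-bounded b≤M) (ρ-bounded c≤M) h)

  rotate-to-end : ∀ x → rotate (suc x) x ≡ M
  rotate-to-end zero = refl
  rotate-to-end (suc x) = rotate-to-end x

Alternating : Edge → Edge → Set
Alternating (a , b) (x , y) = (Cyc a x b × Cyc b y a) ⊎ (Cyc a y b × Cyc b x a)

interleave⇒alternating : ∀ {u v} → Interleave u v → Alternating u v
interleave⇒alternating (inj₁ (a<x , x<b , b<y)) =
  inj₁ (inj₁ (a<x , x<b) , inj₂ (inj₂ (<-trans a<x x<b , b<y)))
interleave⇒alternating (inj₂ (x<a , a<y , y<b)) =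
  inj₂ (inj₁ (a<y , y<b) , inj₂ (inj₁ (x<a , <-trans a<y y<b)))

alternating⇒interleave : ∀ {u v} → proj₁ u ≤ proj₂ u → proj₁ v ≤ proj₂ v →
                         Alternating u v → Interleave u v
alternating⇒interleave a≤b x≤y (inj₁ (axb , bya)) with Cyc-between a≤b axb | Cyc-outside bya
... | a<x , x<b | inj₁ b<y = inj₁ (a<x , x<b , b<y)
... | a<x , _ | inj₂ y<a = ⊥-elim (<-asym a<x (≤-<-trans x≤y y<a))
alternating⇒interleave a≤b x≤y (inj₂ (ayb , bxa)) with Cyc-between a≤b ayb | Cyc-outside bxa
... | a<y , y<b | inj₂ x<a = inj₂ (x<a , a<y , y<b)
... | _ , y<b | inj₁ b<x = ⊥-elim (<-asym y<b (<-≤-trans b<x x≤y))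

SameEnds : Edge → Edge → Set
SameEnds u v = u ≡ v ⊎ u ≡ Product.swap v

SameEnds-sym : ∀ {u v} → SameEnds u v → SameEnds v u
SameEnds-sym (inj₁ refl) = inj₁ refl
SameEnds-sym (inj₂ refl) = inj₂ refl

Alternating-resp : ∀ {u u′ v v′} → SameEnds u u′ → SameEnds v v′ →
                   Alternating u v → Alternating u′ v′
Alternating-resp (inj₁ refl) (inj₁ refl) h = h
Alternating-resp (inj₁ refl) (inj₂ refl) h = Sum.swap h
Alternating-resp (inj₂ refl) (inj₁ refl) h = Sum.swap (Sum.map Product.swap Product.swap h)
Alternating-resp (inj₂ refl) (inj₂ refl) h = Sum.map Product.swap Product.swap h

order : Edge → Edge
order (a , b) = a ⊓ b , a ⊔ b

order-ordered : ∀ u → proj₁ (order u) ≤ proj₂ (order u)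
order-ordered (a , b) = m⊓n≤m⊔n a b

order-SameEnds : ∀ u → SameEnds (order u) u
order-SameEnds (a , b) with ≤-total a b
... | inj₁ a≤b = inj₁ (cong₂ _,_ (m≤n⇒m⊓n≡m a≤b) (m≤n⇒m⊔n≡n a≤b))
... | inj₂ b≤a = inj₂ (cong₂ _,_ (m≥n⇒m⊓n≡n b≤a) (m≥n⇒m⊔n≡m b≤a))

ends : Chord → Edge
ends c = left c , right c

module ChordRotation (M : ℕ) (k : ℕ) where
  open Rotation M

  rotatedPair : Chord → Edge
  rotatedPair c = rotate k (left c) , rotate k (right c)

  rotatedEnds : Chord → Edge
  rotatedEnds c = order (rotatedPair c)

  private
    left≤M : ∀ c → right c ≤ M → left c ≤ M
    left≤M c r≤M = <⇒≤ (<-≤-trans (left<right c) r≤M)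

    rotate-Alternating : ∀ {c d} → right c ≤ M → right d ≤ M →
      Alternating (ends c) (ends d) → Alternating (rotatedPair c) (rotatedPair d)
    rotate-Alternating {c} {d} rc rd =
      Sum.map (Product.map (rotate-Cyc k lc ld rc) (rotate-Cyc k rc rd lc))
              (Product.map (rotate-Cyc k lc rd rc) (rotate-Cyc k rc ld lc))
      where
      lc = left≤M c rc
      ld = left≤M d rd

    rotate-Alternating⁻ : ∀ {c d} → right c ≤ M → right d ≤ M →
      Alternating (rotatedPair c) (rotatedPair d) → Alternating (ends c) (ends d)
    rotate-Alternating⁻ {c} {d} rc rd =
      Sum.map (Product.map (rotate-Cyc⁻ k lc ld rc) (rotate-Cyc⁻ k rc rd lc))
              (Product.map (rotate-Cyc⁻ k lc rd rc) (rotate-Cyc⁻ k rc ld lc))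
      where
      lc = left≤M c rc
      ld = left≤M d rd

  intersect⇒interleave : ∀ {c d} → right c ≤ M → right d ≤ M →
                         Intersect c d → Interleave (rotatedEnds c) (rotatedEnds d)
  intersect⇒interleave {c} {d} c≤M d≤M cross =
    alternating⇒interleave (order-ordered (rotatedPair c)) (order-ordered (rotatedPair d))
      (Alternating-resp (SameEnds-sym (order-SameEnds (rotatedPair c)))
                        (SameEnds-sym (order-SameEnds (rotatedPair d)))
        (rotate-Alternating {c} {d} c≤M d≤M (interleave⇒alternating {ends c} {ends d} cross)))

  interleave⇒intersect : ∀ {c d} → right c ≤ M → right d ≤ M →
                         Interleave (rotatedEnds c) (rotatedEnds d) → Intersect c d
  interleave⇒intersect {c} {d} c≤M d≤M cross =
    alternating⇒interleave (<⇒≤ (left<right c)) (<⇒≤ (left<right d))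
      (rotate-Alternating⁻ {c} {d} c≤M d≤M
        (Alternating-resp (order-SameEnds (rotatedPair c)) (order-SameEnds (rotatedPair d))
          (interleave⇒alternating {rotatedEnds c} {rotatedEnds d} cross)))

OnArc⇒Cyc : ∀ {X Y p} → X ≢ Y → OnArc X Y p → Cyc X p Y
OnArc⇒Cyc _ (inj₁ h) = inj₁ h
OnArc⇒Cyc X≢Y (inj₂ (Y≤X , inj₁ X<p)) = inj₂ (inj₂ (≤∧≢⇒< Y≤X (X≢Y ∘ sym) , X<p))
OnArc⇒Cyc X≢Y (inj₂ (Y≤X , inj₂ p<Y)) = inj₂ (inj₁ (p<Y , ≤∧≢⇒< Y≤X (X≢Y ∘ sym)))

Cyc⇒OnArc : ∀ {X Y p} → Cyc X p Y → OnArc X Y p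
Cyc⇒OnArc (inj₁ h) = inj₁ h
Cyc⇒OnArc (inj₂ (inj₁ (p<Y , Y<X))) = inj₂ (<⇒≤ Y<X , inj₂ p<Y)
Cyc⇒OnArc (inj₂ (inj₂ (Y<X , X<p))) = inj₂ (<⇒≤ Y<X , inj₁ X<p)

-- Cutting the circle open at X (rotating X to the largest point M) turns the
-- arc (X , Y) into the initial segment below the image of Y.
module CutOpen (X Y : ℕ) (X≢Y : X ≢ Y) (𝒜 ℬ : List Chord) where

  M : ℕ
  M = max (X ⊔ Y) (map right (𝒜 ++ ℬ))

  X≤M : X ≤ M
  X≤M = ≤-trans (m≤m⊔n X Y) (⊥≤max (X ⊔ Y) (map right (𝒜 ++ ℬ)))

  Y≤M : Y ≤ M
  Y≤M = ≤-trans (m≤n⊔m X Y) (⊥≤max (X ⊔ Y) (map right (𝒜 ++ ℬ)))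

  right≤M : ∀ {c} → c ∈ 𝒜 ++ ℬ → right c ≤ M
  right≤M c∈ = All.lookup (xs≤max (X ⊔ Y) (map right (𝒜 ++ ℬ))) (∈-map⁺ right c∈)

  left≤M : ∀ {c} → c ∈ 𝒜 ++ ℬ → left c ≤ M
  left≤M {c} c∈ = <⇒≤ (<-≤-trans (left<right c) (right≤M c∈))

  open Rotation M
  open ChordRotation M (suc X) public

  cut : ℕ → ℕ
  cut = rotate (suc X)

  cut-below : ∀ {p} → p ≤ M → OnArc X Y p → cut p < cut Y × cut Y < M
  cut-below {p} p≤M on = between (subst (λ m → Cyc m (cut p) (cut Y)) (rotate-to-end X)
                                    (rotate-Cyc (suc X) X≤M p≤M Y≤M (OnArc⇒Cyc X≢Y on)))
    where
    between : Cyc M (cut p) (cut Y) → cut p < cut Y × cut Y < M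
    between (inj₁ (M<p , _)) = ⊥-elim (<⇒≱ M<p (rotate-bounded (suc X) p≤M))
    between (inj₂ (inj₁ h)) = h
    between (inj₂ (inj₂ (_ , M<p))) = ⊥-elim (<⇒≱ M<p (rotate-bounded (suc X) p≤M))

  cut-above : ∀ {q} → q ≤ M → cut Y < M → ¬ OnArc X Y q → cut Y ≤ cut q
  cut-above {q} q≤M Y<M off = ≮⇒≥ λ q<Y →
    off (Cyc⇒OnArc (rotate-Cyc⁻ (suc X) X≤M q≤M Y≤M
      (subst (λ m → Cyc m (cut q) (cut Y)) (sym (rotate-to-end X)) (inj₂ (inj₁ (q<Y , Y<M))))))

  𝒜-bounded : ∀ {a} → a ∈ 𝒜 → right a ≤ M
  𝒜-bounded = right≤M ∘ ∈-++⁺ˡ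

  ℬ-bounded : ∀ {b} → b ∈ ℬ → right b ≤ M
  ℬ-bounded = right≤M ∘ ∈-++⁺ʳ 𝒜

  module Arrangement
    (one-end : ∀ a → a ∈ 𝒜 →
      (OnArc X Y (left a) × ¬ OnArc X Y (right a))
      ⊎ (¬ OnArc X Y (left a) × OnArc X Y (right a)))
    (on-arc : ∀ b → b ∈ ℬ →
      OnArc X Y (left b) × OnArc X Y (right b) × ∃[ a ] (a ∈ 𝒜 × Intersect a b)) where

    𝒜-straddles : ∀ {a} → a ∈ 𝒜 →
                  proj₁ (rotatedEnds a) < cut Y × cut Y ≤ proj₂ (rotatedEnds a)
    𝒜-straddles {a} a∈ with one-end a a∈
    ... | inj₁ (on , off) =
      let l<Y , Y<M = cut-below (left≤M (∈-++⁺ˡ a∈)) on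
      in ≤-<-trans (m⊓n≤m _ _) l<Y
       , ≤-trans (cut-above (𝒜-bounded a∈) Y<M off) (m≤n⊔m _ _)
    ... | inj₂ (off , on) =
      let r<Y , Y<M = cut-below (𝒜-bounded a∈) on
      in ≤-<-trans (m⊓n≤n _ _) r<Y
       , ≤-trans (cut-above (left≤M (∈-++⁺ˡ a∈)) Y<M off) (m≤m⊔n _ _)

    ℬ-below : ∀ {b} → b ∈ ℬ → proj₂ (rotatedEnds b) < cut Y
    ℬ-below {b} b∈ with on-arc b b∈
    ... | onl , onr , _ = ⊔-pres-<m (proj₁ (cut-below (left≤M (∈-++⁺ʳ 𝒜 b∈)) onl))
                                   (proj₁ (cut-below (ℬ-bounded b∈) onr))

    Inside : Chord → Chord → Set
    Inside a b = proj₁ (rotatedEnds b) < proj₁ (rotatedEnds a)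
               × proj₁ (rotatedEnds a) < proj₂ (rotatedEnds b)

    intersect⇒inside : ∀ {a b} → a ∈ 𝒜 → b ∈ ℬ → Intersect a b → Inside a b
    intersect⇒inside {a} {b} a∈ b∈ cross
      with intersect⇒interleave {a} {b} (𝒜-bounded a∈) (ℬ-bounded b∈) cross
    ... | inj₁ (_ , _ , a₂<b₂) =
      ⊥-elim (<⇒≱ (<-trans a₂<b₂ (ℬ-below b∈)) (proj₂ (𝒜-straddles a∈)))
    ... | inj₂ (b₁<a₁ , a₁<b₂ , _) = b₁<a₁ , a₁<b₂

    inside⇒intersect : ∀ {a b} → a ∈ 𝒜 → b ∈ ℬ → Inside a b → Intersect a b
    inside⇒intersect {a} {b} a∈ b∈ (b₁<a₁ , a₁<b₂) =
      interleave⇒intersect {a} {b} (𝒜-bounded a∈) (ℬ-bounded b∈)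
        (inj₂ (b₁<a₁ , a₁<b₂ , <-≤-trans (ℬ-below b∈) (proj₂ (𝒜-straddles a∈))))

    points : List ℕ
    points = map (proj₁ ∘ rotatedEnds) 𝒜

    intervals : List Edge
    intervals = map rotatedEnds ℬ

    pierced : ∀ {u} → u ∈ intervals → ∃[ p ] (p ∈ points × proj₁ u < p × p < proj₂ u)
    pierced u∈ with ∈-map⁻ rotatedEnds u∈
    ... | b , b∈ , refl with on-arc b b∈
    ...   | _ , _ , a , a∈ , cross =
      proj₁ (rotatedEnds a) , ∈-map⁺ (proj₁ ∘ rotatedEnds) a∈ , intersect⇒inside a∈ b∈ cross

    overlap-avoids-points :
      (∀ x y z → x ∈ 𝒜 ++ ℬ → y ∈ 𝒜 ++ ℬ → z ∈ 𝒜 ++ ℬ →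
        Intersect x y → Intersect y z → Intersect x z → ¬ (x ∈ ℬ × y ∈ ℬ)) →
      ∀ {u v p} → u ∈ intervals → v ∈ intervals → p ∈ points →
      Crosses u v → proj₁ v < p → p < proj₂ u → ⊥
    overlap-avoids-points triangle u∈ v∈ p∈ cross@(u₁<v₁ , _ , u₂<v₂) v₁<p p<u₂
      with ∈-map⁻ rotatedEnds u∈ | ∈-map⁻ rotatedEnds v∈ | ∈-map⁻ (proj₁ ∘ rotatedEnds) p∈
    ... | b , b∈ , refl | b′ , b′∈ , refl | a , a∈ , refl =
      triangle b b′ a (∈-++⁺ʳ 𝒜 b∈) (∈-++⁺ʳ 𝒜 b′∈) (∈-++⁺ˡ a∈)
        (interleave⇒intersect {b} {b′} (ℬ-bounded b∈) (ℬ-bounded b′∈) (inj₁ cross))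
        (Sum.swap (inside⇒intersect a∈ b′∈ (v₁<p , <-trans p<u₂ u₂<v₂)))
        (Sum.swap (inside⇒intersect a∈ b∈ (<-trans u₁<v₁ v₁<p , p<u₂)))
        (b∈ , b′∈)

lemma1 : (X Y : ℕ) → X ≢ Y → (𝒜 ℬ : List Chord) →
  (∀ x y z → x ∈ 𝒜 ++ ℬ → y ∈ 𝒜 ++ ℬ → z ∈ 𝒜 ++ ℬ →
    Intersect x y → Intersect y z → Intersect x z →
    ¬ (x ∈ ℬ × y ∈ ℬ)) →
  (∀ a → a ∈ 𝒜 →
    (OnArc X Y (left a) × ¬ OnArc X Y (right a))
    ⊎ (¬ OnArc X Y (left a) × OnArc X Y (right a))) →
  (∀ b → b ∈ ℬ →
    OnArc X Y (left b) × OnArc X Y (right b)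
    × ∃[ a ] (a ∈ 𝒜 × Intersect a b)) →
  Σ (Chord → Fin 3) λ col →
    ∀ b b′ → b ∈ ℬ → b′ ∈ ℬ → Intersect b b′ → col b ≢ col b′
lemma1 X Y X≢Y 𝒜 ℬ triangle one-end on-arc =
  colour ∘ rotatedEnds ,
  λ b b′ b∈ b′∈ cross → proper (∈-map⁺ rotatedEnds b∈) (∈-map⁺ rotatedEnds b′∈)
                          (intersect⇒interleave {b} {b′} (ℬ-bounded b∈) (ℬ-bounded b′∈) cross)
  where
  open CutOpen X Y X≢Y 𝒜 ℬ
  open Arrangement one-end on-arc
  open Compression points intervals pierced (overlap-avoids-points triangle)

  colour : Edge → Fin 3
  colour = proj₁ crossing-colouring

  proper : ∀ {u v} → u ∈ intervals → v ∈ intervals → Interleave u v → colour u ≢ colour v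
  proper = proj₂ crossing-colouring
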